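{- Both $(\mathcal M_{\bullet,\bullet},\partial_{\mathrm{del}},\partial_{\mathrm{clp}})$ and $(\mathcal M_{\bullet,\bullet},\partial_{\mathrm{lp}},\partial_{\mathrm{con}})$ are bicomplexes; that is, $\partial_{\mathrm{del}}^2=\partial_{\mathrm{clp}}^2=0$ and $\partial_{\mathrm{del}}\partial_{\mathrm{clp}}+\partial_{\mathrm{clp}}\partial_{\mathrm{del}}=0$, and likewise $\partial_{\mathrm{lp}}^2=\partial_{\mathrm{con}}^2=0$ and $\partial_{\mathrm{lp}}\partial_{\mathrm{con}}+\partial_{\mathrm{con}}\partial_{\mathrm{lp}}=0$, where $\partial_{\mathrm{del}},\partial_{\mathrm{lp}}$ have bidegree $(-1,0)$ and $\partial_{\mathrm{clp}},\partial_{\mathrm{con}}$ have bidegree $(0,-1)$.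
   Context: Matroids have finite ground set $E(\mathsf M)$, rank $\mathrm{rk}$ and nullity $\mathrm{nul}(\mathsf M)=|E(\mathsf M)|-\mathrm{rk}(\mathsf M)$. An orientation of $\mathsf M$ is a generator $\eta$ of $\bigwedge^{|E|}\mathbb{Z}\langle E\rangle$, $E=E(\mathsf M)$; $\varnothing$ has orientation $1$. $\mathcal M$ is the $\mathbb{Q}$-vector space spanned by symbols $[\mathsf M,\eta]$ modulo $[\mathsf M,-\eta]=-[\mathsf M,\eta]$ and $[\mathsf M,\eta]=[\mathsf M',\psi_*\eta]$ for every matroid isomorphism $\psi:\mathsf M\to\mathsf M'$ ($\psi_*$ the induced map on top exterior powers), bigraded as $\mathcal M_{\bullet,\bullet}=\bigoplus\mathcal M_{k,r}$ with $\mathcal M_{k,r}$ spanned by classes of nullity $k$ and rank $r$. With $\iota_x$ interior product ($\iota_x(x\wedge\alpha)=\alpha$), the well-defined linear maps are: $\partial_{\mathrm{del}}[\mathsf M,\eta]=\sum_{x\text{ not a coloop}}[\mathsf M\setminus x,\iota_x\eta]$; $\partial_{\mathrm{clp}}[\mathsf M,\eta]=\sum_{x\text{ a coloop}}[\mathsf M\setminus x,\iota_x\eta]$; $\partial_{\mathrm{con}}[\mathsf M,\eta]=\sum_{x\text{ not a loop}}[\mathsf M/x,\iota_x\eta]$; $\partial_{\mathrm{lp}}[\mathsf M,\eta]=\sum_{x\text{ a loop}}[\mathsf M/x,\iota_x\eta]$. Convention: in a bicomplex the first differential is horizontal, the second vertical, and squares anti-commute. -}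

module Defs where

open import Data.Nat using (ℕ; zero; suc; _+_; _∸_; _<_; _⊔_; s≤s; _<ᵇ_)
open import Data.Bool using (Bool; true; false; _∧_; _∨_; not; if_then_else_)
open import Data.Bool.Properties using (∨-identityʳ)
open import Data.Fin using (Fin; zero; suc; toℕ; punchIn; punchOut; _≟_)
open import Data.Fin.Properties using (punchIn-punchOut)
open import Data.Fin.Subset using (Subset; ⊥; ⁅_⁆; _∈_; _∉_; _⊆_; _∪_; ∣_∣)
open import Data.Fin.Subset.Properties using (∪-identityʳ)
open import Data.Fin.Permutation using (Permutation; _⟨$⟩ʳ_; _⟨$⟩ˡ_)
open import Data.Vec using (Vec; []; _∷_; insertAt; lookup; tabulate)
open import Data.Vec.Properties using (insertAt-lookup; insertAt-punchIn; []=⇒lookup; lookup⇒[]=)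
open import Data.List using (List; []; _∷_; _++_; map; concatMap; allFin; foldr)
open import Data.List.Relation.Binary.Permutation.Propositional using (_↭_)
open import Data.List.Relation.Unary.All using (All)
open import Data.Product using (Σ; _×_; _,_; ∃-syntax; proj₁)
open import Data.Rational using (ℚ; 0ℚ; 1ℚ) renaming (_+_ to _+ℚ_; _*_ to _*ℚ_; -_ to -ℚ_)
open import Data.Sign using (Sign; opposite) renaming (+ to ⊕; - to ⊖; _*_ to _*ₛ_)
open import Relation.Nullary using (yes; no; ¬_)
open import Relation.Binary.PropositionalEquality using (_≡_; refl; sym; trans; cong; subst)

record Matroid (n : ℕ) : Set where
  field
    indep     : Subset n → Bool
    indep-∅   : indep ⊥ ≡ true
    indep-⊆   : ∀ {I J} → I ⊆ J → indep J ≡ true → indep I ≡ true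
    indep-aug : ∀ {I J} → indep I ≡ true → indep J ≡ true → ∣ I ∣ < ∣ J ∣ →
                ∃[ y ] (y ∈ J × y ∉ I × indep (I ∪ ⁅ y ⁆) ≡ true)

open Matroid public

allB : ∀ {A : Set} → (A → Bool) → List A → Bool
allB p = foldr (λ a r → p a ∧ r) true

allSubsets : (n : ℕ) → List (Subset n)
allSubsets zero    = [] ∷ []
allSubsets (suc n) = map (false ∷_) (allSubsets n) ++ map (true ∷_) (allSubsets n)

rk : ∀ {n} → Matroid n → ℕ
rk {n} M = foldr (λ I r → if indep M I then ∣ I ∣ ⊔ r else r) 0 (allSubsets n)

nul : ∀ {n} → Matroid n → ℕ
nul {n} M = n ∸ rk M

isBasis : ∀ {n} → Matroid n → Subset n → Bool
isBasis {n} M B = indep M B ∧ allB (λ y → lookup B y ∨ not (indep M (B ∪ ⁅ y ⁆))) (allFin n)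

isLoop : ∀ {n} → Matroid n → Fin n → Bool
isLoop M x = not (indep M ⁅ x ⁆)

isColoop : ∀ {n} → Matroid n → Fin n → Bool
isColoop {n} M x = allB (λ B → not (isBasis M B) ∨ lookup B x) (allSubsets n)

-- The ground set E ∖ {x} of a minor is identified with Fin n
-- via the order-preserving bijection punchIn x : Fin n → Fin (suc n) - x.
-- For S ⊆ Fin n, insertAt S x b is the subset of Fin (suc n) which is
-- (the image of) S together with x iff b.

private
  ins : ∀ {n} → Bool → Fin (suc n) → Subset n → Subset (suc n)
  ins b x S = insertAt S x b

  ins-⊥-false : ∀ {n} (x : Fin (suc n)) → ins false x (⊥ {n}) ≡ ⊥
  ins-⊥-false zero = refl
  ins-⊥-false {suc n} (suc x) = cong (false ∷_) (ins-⊥-false x)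

  ins-⊥-true : ∀ {n} (x : Fin (suc n)) → ins true x (⊥ {n}) ≡ ⁅ x ⁆
  ins-⊥-true zero = refl
  ins-⊥-true {suc n} (suc x) = cong (false ∷_) (ins-⊥-true x)

  ∈-ins⁺ : ∀ {n} b (x : Fin (suc n)) (S : Subset n) {j} → j ∈ S → punchIn x j ∈ ins b x S
  ∈-ins⁺ b x S {j} p = lookup⇒[]= (punchIn x j) (ins b x S) (trans (insertAt-punchIn S x b j) ([]=⇒lookup p))

  ∈-ins⁻ : ∀ {n} b (x : Fin (suc n)) (S : Subset n) {j} → punchIn x j ∈ ins b x S → j ∈ S
  ∈-ins⁻ b x S {j} p = lookup⇒[]= j S (trans (sym (insertAt-punchIn S x b j)) ([]=⇒lookup p))

  ∈-ins-x : ∀ {n} b (x : Fin (suc n)) (S : Subset n) → x ∈ ins b x S → b ≡ true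
  ∈-ins-x b x S p = trans (sym (insertAt-lookup S x b)) ([]=⇒lookup p)

  ∈-ins-x⁺ : ∀ {n} (x : Fin (suc n)) (S : Subset n) → x ∈ ins true x S
  ∈-ins-x⁺ x S = lookup⇒[]= x (ins true x S) (insertAt-lookup S x true)

  ins-⊆ : ∀ {n} b (x : Fin (suc n)) {I J : Subset n} → I ⊆ J → ins b x I ⊆ ins b x J
  ins-⊆ b x {I} {J} I⊆J {i} p with x ≟ i
  ... | yes refl = lookup⇒[]= x (ins b x J) (trans (insertAt-lookup J x b) (∈-ins-x b x I p))
  ... | no x≢i = subst (_∈ ins b x J) (punchIn-punchOut x≢i)
                   (∈-ins⁺ b x J (I⊆J (∈-ins⁻ b x I (subst (_∈ ins b x I) (sym (punchIn-punchOut x≢i)) p))))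

  size-ins : ∀ {n} b (x : Fin (suc n)) (S : Subset n) → ∣ ins b x S ∣ ≡ ∣ b ∷ S ∣
  size-ins b zero S = refl
  size-ins b (suc x) (a ∷ S) with size-ins b x S
  size-ins false (suc x) (false ∷ S) | e = e
  size-ins false (suc x) (true  ∷ S) | e = cong suc e
  size-ins true  (suc x) (false ∷ S) | e = e
  size-ins true  (suc x) (true  ∷ S) | e = cong suc e

  size-ins-< : ∀ {n} b (x : Fin (suc n)) {I J : Subset n} → ∣ I ∣ < ∣ J ∣ → ∣ ins b x I ∣ < ∣ ins b x J ∣
  size-ins-< false x {I} {J} p rewrite size-ins false x I | size-ins false x J = p
  size-ins-< true  x {I} {J} p rewrite size-ins true x I | size-ins true x J = s≤s p

  ins-∪ : ∀ {n} b (x : Fin (suc n)) (I : Subset n) (j : Fin n) →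
          ins b x (I ∪ ⁅ j ⁆) ≡ ins b x I ∪ ⁅ punchIn x j ⁆
  ins-∪ b zero I j = cong (_∷ (I ∪ ⁅ j ⁆)) (sym (∨-identityʳ b))
  ins-∪ b (suc x) (a ∷ I) zero
    rewrite ∪-identityʳ I | ∪-identityʳ (ins b x I) = refl
  ins-∪ b (suc x) (a ∷ I) (suc j) = cong ((a ∨ false) ∷_) (ins-∪ b x I j)

minor : ∀ {n} (M : Matroid (suc n)) (x : Fin (suc n)) (b : Bool) →
        indep M (insertAt ⊥ x b) ≡ true → Matroid n
minor M x b p = record
  { indep     = λ S → indep M (insertAt S x b)
  ; indep-∅   = p
  ; indep-⊆   = λ I⊆J → indep-⊆ M (ins-⊆ b x I⊆J)
  ; indep-aug = aug
  }
  where
  aug : ∀ {I J} → indep M (insertAt I x b) ≡ true → indep M (insertAt J x b) ≡ true →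
        ∣ I ∣ < ∣ J ∣ → ∃[ y ] (y ∈ J × y ∉ I × indep M (insertAt (I ∪ ⁅ y ⁆) x b) ≡ true)
  aug {I} {J} pI pJ lt with indep-aug M pI pJ (size-ins-< b x lt)
  ... | y , y∈J , y∉I , q with x ≟ y
  ...   | yes refl = Data.Empty.⊥-elim (y∉I (subst (λ c → x ∈ ins c x I) (sym (∈-ins-x b x J y∈J)) (∈-ins-x⁺ x I)))
    where import Data.Empty
  ...   | no x≢y =
          let j  = punchOut x≢y
              e  = punchIn-punchOut x≢y
          in j , ∈-ins⁻ b x J (subst (_∈ ins b x J) (sym e) y∈J)
               , (λ j∈I → y∉I (subst (_∈ ins b x I) e (∈-ins⁺ b x I j∈I)))
               , trans (cong (indep M) (trans (ins-∪ b x I j) (cong (λ z → ins b x I ∪ ⁅ z ⁆) e))) q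

delete : ∀ {n} → Matroid (suc n) → Fin (suc n) → Matroid n
delete M x = minor M x false (trans (cong (indep M) (ins-⊥-false x)) (indep-∅ M))

-- contraction M / x  (equal to M ∖ x when x is a loop)
private
  contrOK : ∀ {n} (M : Matroid (suc n)) (x : Fin (suc n)) (b : Bool) →
            indep M ⁅ x ⁆ ≡ b → indep M (insertAt ⊥ x b) ≡ true
  contrOK M x false _ = trans (cong (indep M) (ins-⊥-false x)) (indep-∅ M)
  contrOK M x true  e = trans (cong (indep M) (ins-⊥-true x)) e

contract : ∀ {n} → Matroid (suc n) → Fin (suc n) → Matroid n
contract M x = minor M x (indep M ⁅ x ⁆) (contrOK M x _ refl)

-- Orientations.  The top exterior power of ℤ⟨Fin n⟩ is generated by
-- e₀ ∧ … ∧ e₍ₙ₋₁₎; its two generators are ε·(e₀ ∧ … ∧ e₍ₙ₋₁₎), ε ∈ Sign.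
-- An orientation is represented by this sign ε.

signPow : ℕ → Sign
signPow zero    = ⊕
signPow (suc k) = opposite (signPow k)

-- ι_x (e₀ ∧ … ∧ e₍ₙ₋₁₎) = (-1)^x e₀ ∧ … ê_x … ∧ e₍ₙ₋₁₎, and the remaining
-- wedge is the standard generator for E ∖ {x} ≅ Fin n (order preserving).
ι : ∀ {n} → Fin (suc n) → Sign → Sign
ι x η = signPow (toℕ x) *ₛ η

inversions : ∀ {n m} → Permutation n m → ℕ
inversions {n} π =
  foldr (λ i r → foldr (λ j s → if (toℕ i <ᵇ toℕ j) ∧ (toℕ (π ⟨$⟩ʳ j) <ᵇ toℕ (π ⟨$⟩ʳ i)) then suc s else s) r (allFin n))
        0 (allFin n)

-- ψ_* (e₀ ∧ … ∧ e₍ₙ₋₁₎) = e_{ψ 0} ∧ … ∧ e_{ψ (n-1)} = sign(ψ) · (e₀ ∧ … ∧ e₍ₘ₋₁₎)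
permSign : ∀ {n m} → Permutation n m → Sign
permSign π = signPow (inversions π)

image : ∀ {n m} → Permutation n m → Subset n → Subset m
image π S = tabulate (λ j → lookup S (π ⟨$⟩ˡ j))

IsIso : ∀ {n m} → Permutation n m → Matroid n → Matroid m → Set
IsIso π M M' = ∀ S → indep M' (image π S) ≡ indep M S

-- The space 𝓜: formal ℚ-linear combinations of oriented matroids
-- [M, η], modulo the equivalence generated by the vector space laws of
-- the free vector space and the defining relations.

Gen : Set
Gen = Σ ℕ (λ n → Matroid n × Sign)

FSum : Set
FSum = List (ℚ × Gen)

infix 4 _≈_
data _≈_ : FSum → FSum → Set where
  ≈-refl   : ∀ {x} → x ≈ x
  ≈-sym    : ∀ {x y} → x ≈ y → y ≈ x
  ≈-trans  : ∀ {x y z} → x ≈ y → y ≈ z → x ≈ z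
  ≈-perm   : ∀ {x y} → x ↭ y → x ≈ y
  ≈-cons   : ∀ t {x y} → x ≈ y → t ∷ x ≈ t ∷ y
  ≈-merge  : ∀ q q' g x → (q , g) ∷ (q' , g) ∷ x ≈ (q +ℚ q' , g) ∷ x
  ≈-zero   : ∀ g x → (0ℚ , g) ∷ x ≈ x
  ≈-orient : ∀ q n (M : Matroid n) η x →
             (q , (n , M , opposite η)) ∷ x ≈ (-ℚ q , (n , M , η)) ∷ x
  ≈-iso    : ∀ q {n m} (M : Matroid n) (M' : Matroid m) (ψ : Permutation n m) →
             IsIso ψ M M' → ∀ η x →
             (q , (n , M , η)) ∷ x ≈ (q , (m , M' , permSign ψ *ₛ η)) ∷ x

linExt : (Gen → FSum) → FSum → FSum
linExt f = concatMap (λ t → map (λ u → (proj₁ t *ℚ proj₁ u , Σ.proj₂ u)) (f (Σ.proj₂ t)))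

private
  sumOver : ∀ {n} → (Fin (suc n) → Bool) → (Fin (suc n) → Matroid n) → Sign → FSum
  sumOver {n} sel m η =
    concatMap (λ x → if sel x then (1ℚ , (n , m x , ι x η)) ∷ [] else []) (allFin (suc n))

∂delGen ∂clpGen ∂conGen ∂lpGen : Gen → FSum
∂delGen (zero  , M , η) = []
∂delGen (suc n , M , η) = sumOver (λ x → not (isColoop M x)) (delete M) η
∂clpGen (zero  , M , η) = []
∂clpGen (suc n , M , η) = sumOver (isColoop M) (delete M) η
∂conGen (zero  , M , η) = []
∂conGen (suc n , M , η) = sumOver (λ x → not (isLoop M x)) (contract M) η
∂lpGen  (zero  , M , η) = []
∂lpGen  (suc n , M , η) = sumOver (isLoop M) (contract M) η

∂del ∂clp ∂con ∂lp : FSum → FSum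
∂del = linExt ∂delGen
∂clp = linExt ∂clpGen
∂con = linExt ∂conGen
∂lp  = linExt ∂lpGen

nulG rkG : Gen → ℕ
nulG (n , M , η) = nul M
rkG  (n , M , η) = rk M

Bidegree-10 : (Gen → FSum) → Set
Bidegree-10 d = ∀ g → All (λ t → suc (nulG (Σ.proj₂ t)) ≡ nulG g × rkG (Σ.proj₂ t) ≡ rkG g) (d g)

Bidegree-01 : (Gen → FSum) → Set
Bidegree-01 d = ∀ g → All (λ t → nulG (Σ.proj₂ t) ≡ nulG g × suc (rkG (Σ.proj₂ t)) ≡ rkG g) (d g)

IsBicomplex : (FSum → FSum) → (FSum → FSum) → Set
IsBicomplex d₁ d₂ =
  (∀ x → d₁ (d₁ x) ≈ []) × (∀ x → d₂ (d₂ x) ≈ []) × (∀ x → d₁ (d₂ x) ++ d₂ (d₁ x) ≈ [])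

{-# OPTIONS --safe #-}
module Submission where

-- Each operator removes one element x, and removing x lowers either the rank or the nullity by
-- one: the rank exactly when x is a coloop (deletion), resp. not a loop (contraction); ∂clp and
-- ∂con collect the rank-lowering removals, ∂del and ∂lp the others.  In a composite of two such
-- operators every pair x < y is removed in both orders.  The two double minors coincide, and the
-- two orientations differ by a sign, because y is renumbered once x is gone.  Both routes lose
-- rk M minus the common final rank, so the number of rank drops (0, 1 or 2) is the same along
-- both.  A square ∂∂ keeps the routes with 0 resp. 2 drops and an anticommutator those with
-- exactly 1, so every term comes with its partner of opposite sign.

open import Defs
open import Data.Bool using (Bool; true; false; not; _∧_; _∨_; if_then_else_)
open import Data.Bool.Properties using (not-involutive; ⇔→≡)
open import Data.Fin using (Fin; zero; suc; toℕ; inject₁)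
open import Data.Fin.Permutation using () renaming (id to idₚ)
open import Data.Fin.Properties using (toℕ-inject₁)
open import Data.Fin.Subset using (Subset; ⊥; ⁅_⁆; _∈_; _∉_; _⊆_; _∪_; ∣_∣)
open import Data.Fin.Subset.Properties
  using ( ∣⊥∣≡0; ∣p∣≤n; ∣q∣≤∣p∪q∣; ∪-identityʳ; ∪-comm; drop-∷-⊆; p⊆p∪q; x∈p∪q⁻; x∈p∪q⁺
        ; x∈⁅x⁆; x∈⁅y⁆⇒x≡y; _∈?_; p⊂q⇒∣p∣<∣q∣ )
open import Data.List using (List; []; _∷_; _++_; map; concatMap; allFin; foldr)
open import Data.List.Membership.Propositional using () renaming (_∈_ to _∈ₗ_)
open import Data.List.Membership.Propositional.Properties using (∈-map⁺; ∈-++⁺ˡ; ∈-++⁺ʳ; ∈-allFin)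
open import Data.List.Properties
  using ( ++-assoc; ++-identityʳ; map-++; map-∘; map-cong; map-tabulate; foldr-cong
        ; concatMap-++; concatMap-map; concatMap-cong; map-concatMap )
open import Data.List.Relation.Binary.Permutation.Propositional
  using (_↭_; ↭-refl; ↭-sym; ↭-trans; ↭-reflexive; module PermutationReasoning)
import Data.List.Relation.Binary.Permutation.Propositional.Properties as ↭
open import Data.List.Relation.Unary.All using (All; []; _∷_)
import Data.List.Relation.Unary.All.Properties as All
open import Data.List.Relation.Unary.Any using (here; there)
open import Data.Nat using (ℕ; zero; suc; _+_; _∸_; _≤_; _<_; z≤n; s≤s; _⊔_; _<ᵇ_; _≡ᵇ_)
import Data.Nat.Properties as ℕ
open import Data.Product using (_×_; _,_; proj₁; proj₂; ∃-syntax)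
open import Data.Rational using (ℚ; 1ℚ) renaming (_+_ to _+ℚ_; _*_ to _*ℚ_; -_ to -ℚ_)
import Data.Rational.Properties as ℚ
open import Data.Sign using (Sign; opposite) renaming (+ to ⊕; - to ⊖; _*_ to _*ₛ_)
open import Data.Sum using (inj₁; inj₂)
open import Data.Vec using (Vec; []; _∷_; insertAt; removeAt; lookup; here; there)
open import Data.Vec.Properties
  using (tabulate∘lookup; insertAt-lookup; insertAt-removeAt; []=⇒lookup; lookup⇒[]=)
open import Function using (_∘_; id; mk⇔)
open import Relation.Binary.Bundles using (Setoid)
open import Relation.Binary.PropositionalEquality
  using (_≡_; _≢_; refl; sym; trans; cong; cong₂; subst; subst₂; module ≡-Reasoning)
import Relation.Binary.Reasoning.Setoid as SetoidReasoning
open import Relation.Nullary using (¬_; yes; no; contradiction)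

𝓜 : Setoid _ _
𝓜 = record
  { Carrier       = FSum
  ; _≈_           = _≈_
  ; isEquivalence = record { refl = ≈-refl ; sym = ≈-sym ; trans = ≈-trans }
  }

module ≈-Reasoning = SetoidReasoning 𝓜

≡⇒≈ : ∀ {A B} → A ≡ B → A ≈ B
≡⇒≈ refl = ≈-refl

++-congˡ : ∀ {A A′} B → A ≈ A′ → A ++ B ≈ A′ ++ B
++-congˡ B ≈-refl                   = ≈-refl
++-congˡ B (≈-sym p)                = ≈-sym (++-congˡ B p)
++-congˡ B (≈-trans p q)            = ≈-trans (++-congˡ B p) (++-congˡ B q)
++-congˡ B (≈-perm p)               = ≈-perm (↭.++⁺ʳ B p)
++-congˡ B (≈-cons t p)             = ≈-cons t (++-congˡ B p)
++-congˡ B (≈-merge q q′ g x)       = ≈-merge q q′ g (x ++ B)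
++-congˡ B (≈-zero g x)             = ≈-zero g (x ++ B)
++-congˡ B (≈-orient q n M η x)     = ≈-orient q n M η (x ++ B)
++-congˡ B (≈-iso q M M′ ψ iso η x) = ≈-iso q M M′ ψ iso η (x ++ B)

++-congʳ : ∀ A {B B′} → B ≈ B′ → A ++ B ≈ A ++ B′
++-congʳ []      p = p
++-congʳ (t ∷ A) p = ≈-cons t (++-congʳ A p)

++-cong : ∀ {A A′ B B′} → A ≈ A′ → B ≈ B′ → A ++ B ≈ A′ ++ B′
++-cong {A′ = A′} {B} p q = ≈-trans (++-congˡ B p) (++-congʳ A′ q)

scale : ℚ → FSum → FSum
scale q = map (λ u → (q *ℚ proj₁ u , proj₂ u))

scale-cong : ∀ q {A B} → A ≈ B → scale q A ≈ scale q B
scale-cong q ≈-refl        = ≈-refl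
scale-cong q (≈-sym p)     = ≈-sym (scale-cong q p)
scale-cong q (≈-trans p r) = ≈-trans (scale-cong q p) (scale-cong q r)
scale-cong q (≈-perm p)    = ≈-perm (↭.map⁺ _ p)
scale-cong q (≈-cons t p)  = ≈-cons _ (scale-cong q p)
scale-cong q (≈-merge a b g x) = begin
  (q *ℚ a , g) ∷ (q *ℚ b , g) ∷ scale q x ≈⟨ ≈-merge (q *ℚ a) (q *ℚ b) g _ ⟩
  (q *ℚ a +ℚ q *ℚ b , g) ∷ scale q x      ≡⟨ cong (λ c → (c , g) ∷ scale q x) (ℚ.*-distribˡ-+ q a b) ⟨
  (q *ℚ (a +ℚ b) , g) ∷ scale q x        ∎
  where open ≈-Reasoning
scale-cong q (≈-zero g x) = begin
  (q *ℚ _ , g) ∷ scale q x ≡⟨ cong (λ c → (c , g) ∷ scale q x) (ℚ.*-zeroʳ q) ⟩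
  (_ , g) ∷ scale q x      ≈⟨ ≈-zero g _ ⟩
  scale q x                ∎
  where open ≈-Reasoning
scale-cong q (≈-orient a n M η x) = begin
  (q *ℚ a , (n , M , opposite η)) ∷ scale q x ≈⟨ ≈-orient (q *ℚ a) n M η _ ⟩
  (-ℚ (q *ℚ a) , (n , M , η)) ∷ scale q x     ≡⟨ cong (λ c → (c , _) ∷ scale q x) (ℚ.neg-distribʳ-* q a) ⟩
  (q *ℚ (-ℚ a) , (n , M , η)) ∷ scale q x     ∎
  where open ≈-Reasoning
scale-cong q (≈-iso a M M′ ψ iso η x) = ≈-iso (q *ℚ a) M M′ ψ iso η _

scale-scale : ∀ q q′ A → scale q (scale q′ A) ≡ scale (q *ℚ q′) A
scale-scale q q′ A =
  trans (sym (map-∘ A)) (map-cong (λ u → cong (_, proj₂ u) (sym (ℚ.*-assoc q q′ (proj₁ u)))) A)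

module _ (f : Gen → FSum) where

  linExt-++ : ∀ A B → linExt f (A ++ B) ≡ linExt f A ++ linExt f B
  linExt-++ = concatMap-++ _

  linExt-scale : ∀ q A → linExt f (scale q A) ≡ scale q (linExt f A)
  linExt-scale q []             = refl
  linExt-scale q ((q′ , g) ∷ A) = begin
    scale (q *ℚ q′) (f g) ++ linExt f (scale q A)
      ≡⟨ cong₂ _++_ (sym (scale-scale q q′ (f g))) (linExt-scale q A) ⟩
    scale q (scale q′ (f g)) ++ scale q (linExt f A)
      ≡⟨ map-++ _ (scale q′ (f g)) (linExt f A) ⟨
    scale q (scale q′ (f g) ++ linExt f A)
      ∎
    where open ≡-Reasoning

  linExt-vanishes : (∀ g → f g ≈ []) → ∀ A → linExt f A ≈ []
  linExt-vanishes f≈0 []            = ≈-refl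
  linExt-vanishes f≈0 ((q , g) ∷ A) = ++-cong (scale-cong q (f≈0 g)) (linExt-vanishes f≈0 A)

linExt-∘ : ∀ f h A → linExt f (linExt h A) ≡ linExt (linExt f ∘ h) A
linExt-∘ f h []            = refl
linExt-∘ f h ((q , g) ∷ A) = begin
  linExt f (scale q (h g) ++ linExt h A)
    ≡⟨ linExt-++ f (scale q (h g)) (linExt h A) ⟩
  linExt f (scale q (h g)) ++ linExt f (linExt h A)
    ≡⟨ cong₂ _++_ (linExt-scale f q (h g)) (linExt-∘ f h A) ⟩
  scale q (linExt f (h g)) ++ linExt (linExt f ∘ h) A
    ∎
  where open ≡-Reasoning

linExt-concatMap : ∀ {X : Set} f (h : X → FSum) L → linExt f (concatMap h L) ≡ concatMap (linExt f ∘ h) L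
linExt-concatMap f h []      = refl
linExt-concatMap f h (x ∷ L) =
  trans (linExt-++ f (h x) (concatMap h L)) (cong (linExt f (h x) ++_) (linExt-concatMap f h L))

interchange : ∀ {X : Set} (a b c d : List X) → (a ++ b) ++ (c ++ d) ↭ (a ++ c) ++ (b ++ d)
interchange a b c d = begin
  (a ++ b) ++ (c ++ d) ≡⟨ ++-assoc a b (c ++ d) ⟩
  a ++ (b ++ (c ++ d)) ↭⟨ ↭.++⁺ˡ a (↭.shifts b c) ⟩
  a ++ (c ++ (b ++ d)) ≡⟨ ++-assoc a c (b ++ d) ⟨
  (a ++ c) ++ (b ++ d) ∎
  where open PermutationReasoning

linExt-+ : ∀ f h A → linExt f A ++ linExt h A ↭ linExt (λ g → f g ++ h g) A
linExt-+ f h []            = ↭-refl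
linExt-+ f h ((q , g) ∷ A) =
  ↭-trans (interchange (scale q (f g)) (linExt f A) (scale q (h g)) (linExt h A))
          (↭.++⁺ (↭-reflexive (sym (map-++ _ (f g) (h g)))) (linExt-+ f h A))

square-vanishes : ∀ f → (∀ g → linExt f (f g) ≈ []) → ∀ A → linExt f (linExt f A) ≈ []
square-vanishes f ff≈0 A = ≈-trans (≡⇒≈ (linExt-∘ f f A)) (linExt-vanishes _ ff≈0 A)

anticommutator-vanishes : ∀ f h → (∀ g → linExt f (h g) ++ linExt h (f g) ≈ []) →
                          ∀ A → linExt f (linExt h A) ++ linExt h (linExt f A) ≈ []
anticommutator-vanishes f h fh+hf≈0 A = begin
  linExt f (linExt h A) ++ linExt h (linExt f A)
    ≡⟨ cong₂ _++_ (linExt-∘ f h A) (linExt-∘ h f A) ⟩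
  linExt (linExt f ∘ h) A ++ linExt (linExt h ∘ f) A
    ≈⟨ ≈-perm (linExt-+ (linExt f ∘ h) (linExt h ∘ f) A) ⟩
  linExt (λ g → linExt f (h g) ++ linExt h (f g)) A
    ≈⟨ linExt-vanishes _ fh+hf≈0 A ⟩
  []
    ∎
  where open ≈-Reasoning

linExt²-cong : ∀ {f f′ h h′} → (∀ g → f g ≡ f′ g) → (∀ g → h g ≡ h′ g) →
               ∀ A → linExt f (linExt h A) ≡ linExt f′ (linExt h′ A)
linExt²-cong {f = f} {h′ = h′} f≗f′ h≗h′ A =
  trans (cong (linExt f) (linExt-cong h≗h′ A)) (linExt-cong f≗f′ (linExt h′ A))
  where
  linExt-cong : ∀ {k k′} → (∀ g → k g ≡ k′ g) → ∀ B → linExt k B ≡ linExt k′ B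
  linExt-cong k≗k′ = concatMap-cong (λ t → cong (scale (proj₁ t)) (k≗k′ (proj₂ t)))

IsBicomplex-cong : ∀ {f f′ h h′} → (∀ g → f g ≡ f′ g) → (∀ g → h g ≡ h′ g) →
                   IsBicomplex (linExt f) (linExt h) → IsBicomplex (linExt f′) (linExt h′)
IsBicomplex-cong f≗f′ h≗h′ (ff≈0 , hh≈0 , fh+hf≈0) =
    (λ A → ≈-trans (≡⇒≈ (sym (linExt²-cong f≗f′ f≗f′ A))) (ff≈0 A))
  , (λ A → ≈-trans (≡⇒≈ (sym (linExt²-cong h≗h′ h≗h′ A))) (hh≈0 A))
  , (λ A → ≈-trans (≡⇒≈ (sym (cong₂ _++_ (linExt²-cong f≗f′ h≗h′ A) (linExt²-cong h≗h′ f≗f′ A))))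
                   (fh+hf≈0 A))

concatMap-[] : ∀ {X Y : Set} (L : List X) → concatMap (λ _ → [] {A = Y}) L ≡ []
concatMap-[] []      = refl
concatMap-[] (x ∷ L) = concatMap-[] L

map-if : ∀ {X Y : Set} (f : X → Y) b xs → map f (if b then xs else []) ≡ (if b then map f xs else [])
map-if f true  xs = refl
map-if f false xs = refl

All-concatMap : ∀ {X Y : Set} {P : Y → Set} (h : X → List Y) → (∀ x → All P (h x)) →
                ∀ L → All P (concatMap h L)
All-concatMap h all-h []      = []
All-concatMap h all-h (x ∷ L) = All.++⁺ (all-h x) (All-concatMap h all-h L)

All-if : ∀ {X : Set} {P : X → Set} b {t} → (b ≡ true → P t) → All P (if b then t ∷ [] else [])
All-if true  P-t = P-t refl ∷ []
All-if false P-t = []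

concatMap-allFin-suc : ∀ {X : Set} n (P : Fin (suc n) → List X) →
                       concatMap P (allFin (suc n)) ≡ P zero ++ concatMap (P ∘ suc) (allFin n)
concatMap-allFin-suc n P =
  cong (P zero ++_) (trans (cong (concatMap P) (sym (map-tabulate id suc)))
                           (concatMap-map P suc (allFin n)))

concatMap-+ : ∀ {X Y : Set} (P Q : X → List Y) L →
              concatMap (λ x → P x ++ Q x) L ↭ concatMap P L ++ concatMap Q L
concatMap-+ P Q []      = ↭-refl
concatMap-+ P Q (x ∷ L) =
  ↭-trans (↭.++⁺ˡ (P x ++ Q x) (concatMap-+ P Q L)) (interchange (P x) (Q x) _ _)

concatMap-↭ : ∀ {X Y : Set} {P Q : X → List Y} → (∀ x → P x ↭ Q x) →
              ∀ L → concatMap P L ↭ concatMap Q L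
concatMap-↭ P↭Q []      = ↭-refl
concatMap-↭ P↭Q (x ∷ L) = ↭.++⁺ (P↭Q x) (concatMap-↭ P↭Q L)

concatMap-vanishes : ∀ {X : Set} (P : X → FSum) → (∀ x → P x ≈ []) → ∀ L → concatMap P L ≈ []
concatMap-vanishes P P≈0 []      = ≈-refl
concatMap-vanishes P P≈0 (x ∷ L) = ++-cong (P≈0 x) (concatMap-vanishes P P≈0 L)

sumPairs : ∀ m → (Fin (suc m) → Fin m → FSum) → FSum
sumPairs m H = concatMap (λ x → concatMap (H x) (allFin m)) (allFin (suc m))

sumPairs-cong : ∀ m {H H′ : Fin (suc m) → Fin m → FSum} → (∀ x y → H x y ≡ H′ x y) →
                sumPairs m H ≡ sumPairs m H′
sumPairs-cong m H≡H′ = concatMap-cong (λ x → concatMap-cong (H≡H′ x) (allFin m)) (allFin (suc m))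

sumPairs-+ : ∀ m (F G : Fin (suc m) → Fin m → FSum) →
             sumPairs m (λ x y → F x y ++ G x y) ↭ sumPairs m F ++ sumPairs m G
sumPairs-+ m F G =
  ↭-trans (concatMap-↭ (λ x → concatMap-+ (F x) (G x) (allFin m)) (allFin (suc m)))
          (concatMap-+ (λ x → concatMap (F x) (allFin m)) (λ x → concatMap (G x) (allFin m))
                       (allFin (suc m)))

-- For i ≤ j, the pairs (inject₁ i , j) and (suc j , i) remove the same two elements i and j + 1
-- of Fin (suc m) in the two orders: once i is removed, j + 1 is renumbered j.
sumPairs-vanishes : ∀ m (H : Fin (suc m) → Fin m → FSum) →
                    (∀ (i j : Fin m) → toℕ i ≤ toℕ j → H (inject₁ i) j ++ H (suc j) i ≈ []) →
                    sumPairs m H ≈ []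
sumPairs-vanishes zero    H cancel = ≈-refl
sumPairs-vanishes (suc m) H cancel = begin
  sumPairs (suc m) H
    ≡⟨ split ⟩
  row ++ concatMap (λ x → H (suc x) zero ++ inner x) xs
    ≈⟨ ≈-perm (↭.++⁺ˡ row (concatMap-+ (λ x → H (suc x) zero) inner xs)) ⟩
  row ++ (column ++ rest)
    ≡⟨ ++-assoc row column rest ⟨
  (row ++ column) ++ rest
    ≈⟨ ++-congˡ rest (≈-perm (↭-sym (concatMap-+ (H zero) (λ j → H (suc j) zero) xs))) ⟩
  concatMap (λ j → H zero j ++ H (suc j) zero) xs ++ rest
    ≈⟨ ++-cong (concatMap-vanishes _ (λ j → cancel zero j z≤n) xs) (sumPairs-vanishes m _ cancel-rest) ⟩
  []
    ∎
  where
  open ≈-Reasoning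
  xs     = allFin (suc m)
  inner  = λ x → concatMap (H (suc x) ∘ suc) (allFin m)
  row    = concatMap (H zero) xs
  column = concatMap (λ j → H (suc j) zero) xs
  rest   = sumPairs m (λ x y → H (suc x) (suc y))
  split : sumPairs (suc m) H ≡ row ++ concatMap (λ x → H (suc x) zero ++ inner x) xs
  split = trans (concatMap-allFin-suc (suc m) (λ x → concatMap (H x) xs))
                (cong (row ++_) (concatMap-cong (λ x → concatMap-allFin-suc m (H (suc x))) xs))
  cancel-rest : ∀ (i j : Fin m) → toℕ i ≤ toℕ j → H (suc (inject₁ i)) (suc j) ++ H (suc (suc j)) (suc i) ≈ []
  cancel-rest i j i≤j = cancel (suc i) (suc j) (s≤s i≤j)

<ᵇ-asym : ∀ m n → (m <ᵇ n) ∧ (n <ᵇ m) ≡ false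
<ᵇ-asym zero    zero    = refl
<ᵇ-asym zero    (suc n) = refl
<ᵇ-asym (suc m) zero    = refl
<ᵇ-asym (suc m) (suc n) = <ᵇ-asym m n

permSign-id : ∀ {n} → permSign (idₚ {n}) ≡ ⊕
permSign-id {n} = cong signPow (no-inversions 0 (allFin n))
  where
  inversions-with : Fin n → ℕ → List (Fin n) → ℕ
  inversions-with i = foldr (λ j s → if (toℕ i <ᵇ toℕ j) ∧ (toℕ j <ᵇ toℕ i) then suc s else s)
  no-inversions-with : ∀ i r L → inversions-with i r L ≡ r
  no-inversions-with i r []      = refl
  no-inversions-with i r (j ∷ L) rewrite <ᵇ-asym (toℕ i) (toℕ j) = no-inversions-with i r L
  no-inversions : ∀ r L → foldr (λ i s → inversions-with i s (allFin n)) r L ≡ r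
  no-inversions r []      = refl
  no-inversions r (i ∷ L) = trans (no-inversions-with i _ (allFin n)) (no-inversions r L)

opposite-orientations-cancel : ∀ q n (M M′ : Matroid n) η → (∀ S → indep M S ≡ indep M′ S) →
                               (q , (n , M , η)) ∷ (q , (n , M′ , opposite η)) ∷ [] ≈ []
opposite-orientations-cancel q n M M′ η M≗M′ = begin
  (q , (n , M , η)) ∷ (q , (n , M′ , opposite η)) ∷ []
    ≈⟨ ≈-cons _ (≈-orient q n M′ η []) ⟩
  (q , (n , M , η)) ∷ (-ℚ q , (n , M′ , η)) ∷ []
    ≈⟨ ≈-cons _ (≈-iso (-ℚ q) M′ M idₚ M′≅M η []) ⟩
  (q , (n , M , η)) ∷ (-ℚ q , (n , M , permSign (idₚ {n}) *ₛ η)) ∷ []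
    ≡⟨ cong (λ s → (q , (n , M , η)) ∷ (-ℚ q , (n , M , s *ₛ η)) ∷ []) (permSign-id {n}) ⟩
  (q , (n , M , η)) ∷ (-ℚ q , (n , M , η)) ∷ []
    ≈⟨ ≈-merge q (-ℚ q) (n , M , η) [] ⟩
  (q +ℚ -ℚ q , (n , M , η)) ∷ []
    ≡⟨ cong (λ c → (c , (n , M , η)) ∷ []) (ℚ.+-inverseʳ q) ⟩
  (_ , (n , M , η)) ∷ []
    ≈⟨ ≈-zero _ [] ⟩
  []
    ∎
  where
  open ≈-Reasoning
  M′≅M : IsIso idₚ M′ M
  M′≅M S = trans (cong (indep M) (tabulate∘lookup S)) (M≗M′ S)

swap-opposite : ∀ a b s → b *ₛ (opposite a *ₛ s) ≡ opposite (a *ₛ (b *ₛ s))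
swap-opposite ⊕ ⊕ ⊕ = refl
swap-opposite ⊕ ⊕ ⊖ = refl
swap-opposite ⊕ ⊖ ⊕ = refl
swap-opposite ⊕ ⊖ ⊖ = refl
swap-opposite ⊖ ⊕ ⊕ = refl
swap-opposite ⊖ ⊕ ⊖ = refl
swap-opposite ⊖ ⊖ ⊕ = refl
swap-opposite ⊖ ⊖ ⊖ = refl

bit : Bool → ℕ
bit false = 0
bit true  = 1

-- Matching on the first argument makes true == b and false == b reduce to b and not b, the
-- selectors used by ∂clpGen, ∂delGen and ∂conGen.
_==_ : Bool → Bool → Bool
true  == b = b
false == b = not b

both-equal : ∀ c a b → (c == a) ∧ (c == b) ≡ (bit a + bit b ≡ᵇ bit c + bit c)
both-equal true  true  true  = refl
both-equal true  true  false = refl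
both-equal true  false true  = refl
both-equal true  false false = refl
both-equal false true  true  = refl
both-equal false true  false = refl
both-equal false false true  = refl
both-equal false false false = refl

exactly-one : ∀ {X : Set} a b (t : X) →
              (if a ∧ not b then t ∷ [] else []) ++ (if not a ∧ b then t ∷ [] else []) ≡
              (if bit a + bit b ≡ᵇ 1 then t ∷ [] else [])
exactly-one true  true  t = refl
exactly-one true  false t = refl
exactly-one false true  t = refl
exactly-one false false t = refl

if-pair-cancel : ∀ b {t t′} → t ∷ t′ ∷ [] ≈ [] →
                 (if b then t ∷ [] else []) ++ (if b then t′ ∷ [] else []) ≈ []
if-pair-cancel true  t+t′≈0 = t+t′≈0
if-pair-cancel false _      = ≈-refl

∉⇒lookup≡false : ∀ {n} {p : Subset n} {x} → x ∉ p → lookup p x ≡ false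
∉⇒lookup≡false {p = p} {x} x∉p with lookup p x in px
... | false = refl
... | true  = contradiction (lookup⇒[]= x p px) x∉p

∣p∪⁅x⁆∣≡1+∣p∣ : ∀ {n} {p : Subset n} {x} → x ∉ p → ∣ p ∪ ⁅ x ⁆ ∣ ≡ suc ∣ p ∣
∣p∪⁅x⁆∣≡1+∣p∣ {p = false ∷ p} {zero}  x∉p = cong (suc ∘ ∣_∣) (∪-identityʳ p)
∣p∪⁅x⁆∣≡1+∣p∣ {p = true  ∷ p} {zero}  x∉p = contradiction here x∉p
∣p∪⁅x⁆∣≡1+∣p∣ {p = false ∷ p} {suc x} x∉p = ∣p∪⁅x⁆∣≡1+∣p∣ (x∉p ∘ there)
∣p∪⁅x⁆∣≡1+∣p∣ {p = true  ∷ p} {suc x} x∉p = cong suc (∣p∪⁅x⁆∣≡1+∣p∣ (x∉p ∘ there))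

∣insertAt∣ : ∀ {n} (S : Subset n) x b → ∣ insertAt S x b ∣ ≡ bit b + ∣ S ∣
∣insertAt∣ S           zero    false = refl
∣insertAt∣ S           zero    true  = refl
∣insertAt∣ (false ∷ S) (suc x) b     = ∣insertAt∣ S x b
∣insertAt∣ (true  ∷ S) (suc x) b     = trans (cong suc (∣insertAt∣ S x b)) (sym (ℕ.+-suc (bit b) ∣ S ∣))

∣I∣≡∣removeAt∣ : ∀ {n} (I : Subset (suc n)) x → ∣ I ∣ ≡ bit (lookup I x) + ∣ removeAt I x ∣
∣I∣≡∣removeAt∣ I x =
  trans (cong ∣_∣ (sym (insertAt-removeAt I x))) (∣insertAt∣ (removeAt I x) x (lookup I x))

insertAt-⊆ : ∀ {n} (x : Fin (suc n)) {I J : Subset n} {a b} → I ⊆ J → (a ≡ true → b ≡ true) →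
             insertAt I x a ⊆ insertAt J x b
insertAt-⊆ zero    {J = J} I⊆J a⇒b here                 = lookup⇒[]= zero (_ ∷ J) (a⇒b refl)
insertAt-⊆ zero    I⊆J a⇒b (there i∈I)                  = there (I⊆J i∈I)
insertAt-⊆ (suc x) {true ∷ _} I⊆J a⇒b here with I⊆J here
... | here = here
insertAt-⊆ (suc x) {_ ∷ _} {_ ∷ _} I⊆J a⇒b (there i∈I) = there (insertAt-⊆ x (drop-∷-⊆ I⊆J) a⇒b i∈I)

⁅x⁆⊆p : ∀ {n} {x : Fin n} {p} → x ∈ p → ⁅ x ⁆ ⊆ p
⁅x⁆⊆p {x = x} {p} x∈p y∈⁅x⁆ = subst (_∈ p) (sym (x∈⁅y⁆⇒x≡y x y∈⁅x⁆)) x∈p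

insertAt-comm : ∀ {X : Set} {n} (T : Vec X n) (i j : Fin (suc n)) a b → toℕ i ≤ toℕ j →
                insertAt (insertAt T j b) (inject₁ i) a ≡ insertAt (insertAt T i a) (suc j) b
insertAt-comm T       zero    j       a b i≤j       = refl
insertAt-comm (t ∷ T) (suc i) (suc j) a b (s≤s i≤j) = cong (t ∷_) (insertAt-comm T i j a b i≤j)

insertAt-∪ : ∀ {n} (S S′ : Subset n) x a c →
             insertAt (S ∪ S′) x (a ∨ c) ≡ insertAt S x a ∪ insertAt S′ x c
insertAt-∪ S       S′        zero    a c = refl
insertAt-∪ (s ∷ S) (s′ ∷ S′) (suc x) a c = cong ((s ∨ s′) ∷_) (insertAt-∪ S S′ x a c)

insertAt-⊥-false : ∀ {n} (x : Fin (suc n)) → insertAt ⊥ x false ≡ ⊥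
insertAt-⊥-false         zero    = refl
insertAt-⊥-false {suc n} (suc x) = cong (false ∷_) (insertAt-⊥-false x)

insertAt-⊥-true : ∀ {n} (x : Fin (suc n)) → insertAt ⊥ x true ≡ ⁅ x ⁆
insertAt-⊥-true         zero    = refl
insertAt-⊥-true {suc n} (suc x) = cong (false ∷_) (insertAt-⊥-true x)

⊆∧∣∣≤⇒⊇ : ∀ {n} {p q : Subset n} → p ⊆ q → ∣ q ∣ ≤ ∣ p ∣ → q ⊆ p
⊆∧∣∣≤⇒⊇ {p = p} p⊆q ∣q∣≤∣p∣ {x} x∈q with x ∈? p
... | yes x∈p = x∈p
... | no  x∉p = contradiction ∣q∣≤∣p∣ (ℕ.<⇒≱ (p⊂q⇒∣p∣<∣q∣ (p⊆q , x , x∈q , x∉p)))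

-- Rank, bases and augmentation

allB-sound : ∀ {X : Set} (p : X → Bool) L → allB p L ≡ true → ∀ {a} → a ∈ₗ L → p a ≡ true
allB-sound p (b ∷ L) all a∈ with p b in pb | a∈
allB-sound p (b ∷ L) all a∈ | true  | here refl = pb
allB-sound p (b ∷ L) all a∈ | true  | there a∈L = allB-sound p L all a∈L
allB-sound p (b ∷ L) ()  a∈ | false | _

allB-complete : ∀ {X : Set} (p : X → Bool) L → (∀ a → p a ≡ true) → allB p L ≡ true
allB-complete p []      p≡true = refl
allB-complete p (b ∷ L) p≡true rewrite p≡true b = allB-complete p L p≡true

allB-counterexample : ∀ {X : Set} (p : X → Bool) L → allB p L ≡ false → ∃[ a ] p a ≡ false
allB-counterexample p (b ∷ L) all with p b in pb
... | false = b , pb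
... | true  = allB-counterexample p L all

∈-allSubsets : ∀ {n} (S : Subset n) → S ∈ₗ allSubsets n
∈-allSubsets         []          = here refl
∈-allSubsets         (false ∷ S) = ∈-++⁺ˡ (∈-map⁺ (false ∷_) (∈-allSubsets S))
∈-allSubsets {suc n} (true  ∷ S) = ∈-++⁺ʳ (map (false ∷_) (allSubsets n)) (∈-map⁺ (true ∷_) (∈-allSubsets S))

rankOver : ∀ {n} → Matroid n → List (Subset n) → ℕ
rankOver M = foldr (λ I r → if indep M I then ∣ I ∣ ⊔ r else r) 0

module _ {n} (M : Matroid n) where

  ∣I∣≤rankOver : ∀ L {I} → I ∈ₗ L → indep M I ≡ true → ∣ I ∣ ≤ rankOver M L
  ∣I∣≤rankOver (J ∷ L) (here refl) indI rewrite indI = ℕ.m≤m⊔n ∣ J ∣ (rankOver M L)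
  ∣I∣≤rankOver (J ∷ L) (there I∈L) indI with indep M J
  ... | true  = ℕ.≤-trans (∣I∣≤rankOver L I∈L indI) (ℕ.m≤n⊔m ∣ J ∣ (rankOver M L))
  ... | false = ∣I∣≤rankOver L I∈L indI

  rankOver-attained : ∀ L → ∃[ I ] (indep M I ≡ true × ∣ I ∣ ≡ rankOver M L)
  rankOver-attained []      = ⊥ , indep-∅ M , ∣⊥∣≡0 n
  rankOver-attained (J ∷ L) with indep M J in indJ | rankOver-attained L
  ... | false | max = max
  ... | true  | (I , indI , ∣I∣≡) with ℕ.⊔-sel ∣ J ∣ (rankOver M L)
  ...   | inj₁ J-wins = J , indJ , sym J-wins
  ...   | inj₂ L-wins = I , indI , trans ∣I∣≡ (sym L-wins)

  ∣I∣≤rk : ∀ {I} → indep M I ≡ true → ∣ I ∣ ≤ rk M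
  ∣I∣≤rk = ∣I∣≤rankOver (allSubsets n) (∈-allSubsets _)

  maximum-independent : ∃[ I ] (indep M I ≡ true × ∣ I ∣ ≡ rk M)
  maximum-independent = rankOver-attained (allSubsets n)

  rk≤n : rk M ≤ n
  rk≤n with maximum-independent
  ... | (I , _ , ∣I∣≡rk) = subst (_≤ n) ∣I∣≡rk (∣p∣≤n I)

rk-cong : ∀ {n} {M M′ : Matroid n} → (∀ S → indep M S ≡ indep M′ S) → rk M ≡ rk M′
rk-cong {n} M≗M′ = foldr-cong (λ I r → cong (λ b → if b then ∣ I ∣ ⊔ r else r) (M≗M′ I)) refl (allSubsets n)

module _ {n} (M : Matroid n) where

  basis⇒∣B∣≡rk : ∀ {B} → isBasis M B ≡ true → ∣ B ∣ ≡ rk M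
  basis⇒∣B∣≡rk {B} basis with indep M B in indB
  ... | true = ℕ.≤-antisym (∣I∣≤rk M indB) (ℕ.≮⇒≥ ¬∣B∣<rk)
    where
    ¬∣B∣<rk : ¬ (∣ B ∣ < rk M)
    ¬∣B∣<rk ∣B∣<rk with maximum-independent M
    ... | (I , indI , ∣I∣≡rk) with indep-aug M indB indI (subst (∣ B ∣ <_) (sym ∣I∣≡rk) ∣B∣<rk)
    ...   | (y , _ , y∉B , indB+y) with allB-sound _ (allFin n) basis (∈-allFin y)
    ...     | maximal rewrite ∉⇒lookup≡false y∉B | indB+y = contradiction maximal λ ()

  maximum⇒basis : ∀ {B} → indep M B ≡ true → ∣ B ∣ ≡ rk M → isBasis M B ≡ true
  maximum⇒basis {B} indB ∣B∣≡rk rewrite indB = allB-complete _ (allFin n) maximal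
    where
    maximal : ∀ y → lookup B y ∨ not (indep M (B ∪ ⁅ y ⁆)) ≡ true
    maximal y with lookup B y in By
    ... | true  = refl
    ... | false with indep M (B ∪ ⁅ y ⁆) in indB+y
    ...   | false = refl
    ...   | true  = contradiction (∣I∣≤rk M indB+y) (ℕ.<⇒≱ rk<∣B+y∣)
      where
      rk<∣B+y∣ : rk M < ∣ B ∪ ⁅ y ⁆ ∣
      y∉B : y ∉ B
      y∉B y∈B = contradiction (trans (sym ([]=⇒lookup y∈B)) By) λ ()
      rk<∣B+y∣ = subst₂ _<_ ∣B∣≡rk (sym (∣p∪⁅x⁆∣≡1+∣p∣ y∉B)) (ℕ.n<1+n _)

  basis⇒independent : ∀ {B} → isBasis M B ≡ true → indep M B ≡ true
  basis⇒independent {B} basis with indep M B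
  ... | true = refl

  coloop∈maximum : ∀ {x I} → isColoop M x ≡ true → indep M I ≡ true → ∣ I ∣ ≡ rk M → lookup I x ≡ true
  coloop∈maximum {x} {I} coloop indI ∣I∣≡rk =
    subst (λ b → not b ∨ lookup I x ≡ true) (maximum⇒basis indI ∣I∣≡rk)
          (allB-sound _ (allSubsets n) coloop (∈-allSubsets I))

  non-coloop-avoided : ∀ {x} → isColoop M x ≡ false →
                       ∃[ B ] (indep M B ≡ true × ∣ B ∣ ≡ rk M × lookup B x ≡ false)
  non-coloop-avoided {x} non-coloop with allB-counterexample _ (allSubsets n) non-coloop
  ... | (B , B-avoids-x) with isBasis M B in basis | lookup B x in Bx
  ...   | true | false = B , basis⇒independent basis , basis⇒∣B∣≡rk basis , Bx

module _ {n} (M : Matroid n) {J} (indJ : indep M J ≡ true) where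

  augment-by : ∀ d {I} → indep M I ≡ true → d + ∣ I ∣ ≡ ∣ J ∣ →
               ∃[ K ] (indep M K ≡ true × I ⊆ K × K ⊆ I ∪ J × ∣ K ∣ ≡ ∣ J ∣)
  augment-by zero    {I} indI ∣I∣≡∣J∣ = I , indI , id , p⊆p∪q J , ∣I∣≡∣J∣
  augment-by (suc d) {I} indI d+∣I∣≡∣J∣
    with indep-aug M indI indJ (subst (∣ I ∣ <_) d+∣I∣≡∣J∣ (s≤s (ℕ.m≤n+m ∣ I ∣ d)))
  ... | (y , y∈J , y∉I , indI+y)
    with augment-by d indI+y (trans (cong (d +_) (∣p∪⁅x⁆∣≡1+∣p∣ y∉I)) (trans (ℕ.+-suc d ∣ I ∣) d+∣I∣≡∣J∣))
  ...   | (K , indK , I+y⊆K , K⊆I+y∪J , ∣K∣≡∣J∣) =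
          K , indK , I+y⊆K ∘ p⊆p∪q ⁅ y ⁆ , absorb ∘ K⊆I+y∪J , ∣K∣≡∣J∣
    where
    absorb : (I ∪ ⁅ y ⁆) ∪ J ⊆ I ∪ J
    absorb {k} k∈ with x∈p∪q⁻ (I ∪ ⁅ y ⁆) J k∈
    ... | inj₂ k∈J = x∈p∪q⁺ (inj₂ k∈J)
    ... | inj₁ k∈I+y with x∈p∪q⁻ I ⁅ y ⁆ k∈I+y
    ...   | inj₁ k∈I = x∈p∪q⁺ (inj₁ k∈I)
    ...   | inj₂ k∈⁅y⁆ = x∈p∪q⁺ (inj₂ (⁅x⁆⊆p y∈J k∈⁅y⁆))

  augment : ∀ {I} → indep M I ≡ true → ∣ I ∣ ≤ ∣ J ∣ →
            ∃[ K ] (indep M K ≡ true × I ⊆ K × K ⊆ I ∪ J × ∣ K ∣ ≡ ∣ J ∣)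
  augment {I} indI ∣I∣≤∣J∣ = augment-by (∣ J ∣ ∸ ∣ I ∣) indI (ℕ.m∸n+n≡m ∣I∣≤∣J∣)

dependent-⊆ : ∀ {n} (M : Matroid n) {I J} → I ⊆ J → indep M I ≡ false → indep M J ≡ false
dependent-⊆ M {J = J} I⊆J depI with indep M J in indJ
... | false = refl
... | true  = contradiction (trans (sym (indep-⊆ M I⊆J indJ)) depI) λ ()

-- Augmenting {y} from U ∪ {x} never adds x, as {x, y} is dependent.
parallel-exchange : ∀ {n} (M : Matroid n) {U x y} →
                    indep M (U ∪ ⁅ x ⁆) ≡ true → indep M ⁅ y ⁆ ≡ true → indep M (⁅ x ⁆ ∪ ⁅ y ⁆) ≡ false →
                    ∣ U ∪ ⁅ y ⁆ ∣ ≤ ∣ U ∪ ⁅ x ⁆ ∣ → indep M (U ∪ ⁅ y ⁆) ≡ true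
parallel-exchange M {U} {x} {y} indU+x indy dep-xy ∣U+y∣≤∣U+x∣
  with augment M indU+x indy (ℕ.≤-trans (∣q∣≤∣p∪q∣ U ⁅ y ⁆) ∣U+y∣≤∣U+x∣)
... | (K , indK , y⊆K , K⊆y∪U+x , ∣K∣≡∣U+x∣) =
  indep-⊆ M (⊆∧∣∣≤⇒⊇ K⊆U+y (subst (∣ U ∪ ⁅ y ⁆ ∣ ≤_) (sym ∣K∣≡∣U+x∣) ∣U+y∣≤∣U+x∣)) indK
  where
  x∉K : x ∉ K
  x∉K x∈K = contradiction (trans (sym (indep-⊆ M xy⊆K indK)) dep-xy) λ ()
    where
    xy⊆K : ⁅ x ⁆ ∪ ⁅ y ⁆ ⊆ K
    xy⊆K k∈ with x∈p∪q⁻ ⁅ x ⁆ ⁅ y ⁆ k∈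
    ... | inj₁ k∈⁅x⁆ = ⁅x⁆⊆p x∈K k∈⁅x⁆
    ... | inj₂ k∈⁅y⁆ = y⊆K k∈⁅y⁆
  K⊆U+y : K ⊆ U ∪ ⁅ y ⁆
  K⊆U+y {k} k∈K with x∈p∪q⁻ ⁅ y ⁆ (U ∪ ⁅ x ⁆) (K⊆y∪U+x k∈K)
  ... | inj₁ k∈⁅y⁆ = x∈p∪q⁺ (inj₂ k∈⁅y⁆)
  ... | inj₂ k∈U+x with x∈p∪q⁻ U ⁅ x ⁆ k∈U+x
  ...   | inj₁ k∈U   = x∈p∪q⁺ (inj₁ k∈U)
  ...   | inj₂ k∈⁅x⁆ = contradiction (subst (_∈ K) (x∈⁅y⁆⇒x≡y x k∈⁅x⁆) k∈K) x∉K

-- Deletion and contraction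

-- b = false describes M′ = M ∖ x, and b = true describes M′ = M / x for x not a loop.
record IsMinorAt {n} (M′ : Matroid n) (M : Matroid (suc n)) (x : Fin (suc n)) (b : Bool) : Set where
  constructor minorAt
  field indep-minor : ∀ S → indep M′ S ≡ indep M (insertAt S x b)

deletion : ∀ {n} (M : Matroid (suc n)) x → IsMinorAt (delete M x) M x false
deletion M x = minorAt λ S → refl

module _ {n} {M′ : Matroid n} {M : Matroid (suc n)} {x b} (minor : IsMinorAt M′ M x b) where

  open IsMinorAt minor

  rk-minor≤ : bit b + rk M′ ≤ rk M
  rk-minor≤ with maximum-independent M′
  ... | (I′ , indI′ , ∣I′∣≡rk) =
    subst (_≤ rk M) (trans (∣insertAt∣ I′ x b) (cong (bit b +_) ∣I′∣≡rk))
          (∣I∣≤rk M (trans (sym (indep-minor I′)) indI′))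

  ∣I∣≤rk-minor : ∀ {I} → indep M I ≡ true → lookup I x ≡ b → ∣ I ∣ ≤ bit b + rk M′
  ∣I∣≤rk-minor {I} indI Ix≡b = begin
    ∣ I ∣                        ≡⟨ ∣I∣≡∣removeAt∣ I x ⟩
    bit (lookup I x) + ∣ I′ ∣    ≡⟨ cong (λ c → bit c + ∣ I′ ∣) Ix≡b ⟩
    bit b + ∣ I′ ∣               ≤⟨ ℕ.+-monoʳ-≤ (bit b) (∣I∣≤rk M′ indI′) ⟩
    bit b + rk M′                ∎
    where
    open ℕ.≤-Reasoning
    I′ = removeAt I x
    I′+x≡I : insertAt I′ x b ≡ I
    I′+x≡I = subst (λ c → insertAt I′ x c ≡ I) Ix≡b (insertAt-removeAt I x)
    indI′ : indep M′ I′ ≡ true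
    indI′ = trans (indep-minor I′) (trans (cong (indep M) I′+x≡I) indI)

rk≤1+rk-delete : ∀ {n} (M : Matroid (suc n)) x → rk M ≤ suc (rk (delete M x))
rk≤1+rk-delete M x with maximum-independent M
... | (I , indI , ∣I∣≡rk) = begin
  rk M                                    ≡⟨ ∣I∣≡rk ⟨
  ∣ I ∣                                   ≡⟨ ∣I∣≡∣removeAt∣ I x ⟩
  bit (lookup I x) + ∣ removeAt I x ∣     ≤⟨ ℕ.+-mono-≤ (bit≤1 (lookup I x)) (∣I∣≤rk (delete M x) I∖x-independent) ⟩
  suc (rk (delete M x))                   ∎
  where
  open ℕ.≤-Reasoning
  bit≤1 : ∀ c → bit c ≤ 1
  bit≤1 false = z≤n
  bit≤1 true  = s≤s z≤n
  I∖x-independent : indep M (insertAt (removeAt I x) x false) ≡ true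
  I∖x-independent =
    indep-⊆ M (subst (insertAt (removeAt I x) x false ⊆_) (insertAt-removeAt I x) (insertAt-⊆ x id λ ())) indI

rk-delete : ∀ {n} (M : Matroid (suc n)) x → rk M ≡ bit (isColoop M x) + rk (delete M x)
rk-delete M x with isColoop M x in coloop
... | false with non-coloop-avoided M coloop
...   | (B , indB , ∣B∣≡rk , Bx) =
        ℕ.≤-antisym (subst (_≤ rk (delete M x)) ∣B∣≡rk (∣I∣≤rk-minor (deletion M x) indB Bx))
                    (rk-minor≤ (deletion M x))
rk-delete M x | true = ℕ.≤-antisym (rk≤1+rk-delete M x) (ℕ.≤∧≢⇒< (rk-minor≤ (deletion M x)) rk-drops)
  where
  rk-drops : rk (delete M x) ≢ rk M
  rk-drops rk-kept with maximum-independent (delete M x)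
  ... | (I′ , indI′ , ∣I′∣≡rk) =
    contradiction (trans (sym (coloop∈maximum M coloop indI′ maximum)) (insertAt-lookup I′ x false)) λ ()
    where
    maximum : ∣ insertAt I′ x false ∣ ≡ rk M
    maximum = trans (∣insertAt∣ I′ x false) (trans ∣I′∣≡rk rk-kept)

contraction : ∀ {n} (M : Matroid (suc n)) x {b} → indep M ⁅ x ⁆ ≡ b → IsMinorAt (contract M x) M x b
contraction M x indx = minorAt λ S → cong (λ c → indep M (insertAt S x c)) indx

rk-contract : ∀ {n} (M : Matroid (suc n)) x → rk M ≡ bit (not (isLoop M x)) + rk (contract M x)
rk-contract M x = rk-contract-by (indep M ⁅ x ⁆) refl
  where
  rk-contract-by : ∀ b → indep M ⁅ x ⁆ ≡ b → rk M ≡ bit (not (not b)) + rk (contract M x)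
  rk-contract-by b indx with maximum-independent M
  rk-contract-by true indx | (J , indJ , ∣J∣≡rk)
    with augment M indJ indx (subst (∣ ⁅ x ⁆ ∣ ≤_) (sym ∣J∣≡rk) (∣I∣≤rk M indx))
  ... | (K , indK , x⊆K , _ , ∣K∣≡∣J∣) =
    ℕ.≤-antisym (subst (_≤ _) (trans ∣K∣≡∣J∣ ∣J∣≡rk) (∣I∣≤rk-minor (contraction M x indx) indK x∈K))
                (rk-minor≤ (contraction M x indx))
    where
    x∈K : lookup K x ≡ true
    x∈K = []=⇒lookup (x⊆K (x∈⁅x⁆ x))
  rk-contract-by false indx | (J , indJ , ∣J∣≡rk) =
    ℕ.≤-antisym (subst (_≤ _) ∣J∣≡rk (∣I∣≤rk-minor (contraction M x indx) indJ (∉⇒lookup≡false x∉J)))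
                (rk-minor≤ (contraction M x indx))
    where
    x∉J : x ∉ J
    x∉J x∈J = contradiction (trans (sym (indep-⊆ M (⁅x⁆⊆p x∈J) indJ)) indx) λ ()

rank-drop⇒nullity-kept : ∀ {n} {M : Matroid (suc n)} {M′ : Matroid n} →
                         rk M ≡ suc (rk M′) → nul M′ ≡ nul M × suc (rk M′) ≡ rk M
rank-drop⇒nullity-kept rk-drop rewrite rk-drop = refl , refl

rank-kept⇒nullity-drop : ∀ {n} {M : Matroid (suc n)} {M′ : Matroid n} →
                         rk M ≡ rk M′ → suc (nul M′) ≡ nul M × rk M′ ≡ rk M
rank-kept⇒nullity-drop {M′ = M′} rk-kept rewrite rk-kept = sym (ℕ.+-∸-assoc 1 (rk≤n M′)) , refl

module _ {n} (M : Matroid (suc (suc n))) {i j : Fin (suc n)} (i≤j : toℕ i ≤ toℕ j) where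

  delete-comm : ∀ T → indep (delete (delete M (inject₁ i)) j) T ≡ indep (delete (delete M (suc j)) i) T
  delete-comm T = cong (indep M) (insertAt-comm T i j false false i≤j)

  private
    x y : Fin (suc (suc n))
    x = inject₁ i
    y = suc j

    W : Subset n → Bool → Bool → Subset (suc (suc n))
    W T a b = insertAt (insertAt T i a) y b

    indW : Subset n → Bool → Bool → Bool
    indW T a b = indep M (W T a b)

    W-∪ : ∀ T T′ a a′ b b′ → W (T ∪ T′) (a ∨ a′) (b ∨ b′) ≡ W T a b ∪ W T′ a′ b′
    W-∪ T T′ a a′ b b′ = trans (cong (λ S → insertAt S y (b ∨ b′)) (insertAt-∪ T T′ i a a′))
                               (insertAt-∪ (insertAt T i a) (insertAt T′ i a′) y b b′)

    ⁅x⁆+y : ∀ b → insertAt ⁅ i ⁆ y b ≡ W ⊥ true b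
    ⁅x⁆+y b = cong (λ S → insertAt S y b) (sym (insertAt-⊥-true i))

    ⁅y⁆+x : ∀ a → insertAt ⁅ j ⁆ x a ≡ W ⊥ a true
    ⁅y⁆+x a = trans (cong (λ S → insertAt S x a) (sym (insertAt-⊥-true j)))
                    (insertAt-comm ⊥ i j a true i≤j)

    ⁅x⁆≡W : ⁅ x ⁆ ≡ W ⊥ true false
    ⁅x⁆≡W = trans (sym (insertAt-⊥-true x))
                  (trans (cong (λ S → insertAt S x true) (sym (insertAt-⊥-false j)))
                         (insertAt-comm ⊥ i j true false i≤j))

    ⁅y⁆≡W : ⁅ y ⁆ ≡ W ⊥ false true
    ⁅y⁆≡W = trans (sym (insertAt-⊥-true y)) (cong (λ S → insertAt S y true) (sym (insertAt-⊥-false i)))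

    W+x : ∀ T → W T true false ≡ W T false false ∪ ⁅ x ⁆
    W+x T = trans (cong (λ S → W S true false) (sym (∪-identityʳ T)))
                  (trans (W-∪ T ⊥ false true false false) (cong (W T false false ∪_) (sym ⁅x⁆≡W)))

    W+y : ∀ T → W T false true ≡ W T false false ∪ ⁅ y ⁆
    W+y T = trans (cong (λ S → W S false true) (sym (∪-identityʳ T)))
                  (trans (W-∪ T ⊥ false false false true) (cong (W T false false ∪_) (sym ⁅y⁆≡W)))

    W+xy : W ⊥ true true ≡ ⁅ x ⁆ ∪ ⁅ y ⁆
    W+xy = trans (cong (λ S → W S true true) (sym (∪-identityʳ ⊥)))
                 (trans (W-∪ ⊥ ⊥ true false false true) (cong₂ _∪_ (sym ⁅x⁆≡W) (sym ⁅y⁆≡W)))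

    ∣W∣ : ∀ T a b → ∣ W T a b ∣ ≡ bit b + (bit a + ∣ T ∣)
    ∣W∣ T a b = trans (∣insertAt∣ (insertAt T i a) y b) (cong (bit b +_) (∣insertAt∣ T i a))

    parallel : indW ⊥ true false ≡ true → indW ⊥ false true ≡ true → indW ⊥ true true ≡ false →
               ∀ T → indW T true false ≡ indW T false true
    parallel indx indy dep-xy T = ⇔→≡ (mk⇔ (exchange x y (W+x T) (W+y T) indy′ dep (ℕ.≤-reflexive ∣U+y∣≡∣U+x∣))
                                         (exchange y x (W+y T) (W+x T) indx′ dep′ (ℕ.≤-reflexive (sym ∣U+y∣≡∣U+x∣))))
      where
      U = W T false false
      ∣U+y∣≡∣U+x∣ : ∣ U ∪ ⁅ y ⁆ ∣ ≡ ∣ U ∪ ⁅ x ⁆ ∣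
      ∣U+y∣≡∣U+x∣ = trans (cong ∣_∣ (sym (W+y T)))
                          (trans (∣W∣ T false true) (trans (sym (∣W∣ T true false)) (cong ∣_∣ (W+x T))))
      indx′ : indep M ⁅ x ⁆ ≡ true
      indx′ = trans (cong (indep M) ⁅x⁆≡W) indx
      indy′ : indep M ⁅ y ⁆ ≡ true
      indy′ = trans (cong (indep M) ⁅y⁆≡W) indy
      dep : indep M (⁅ x ⁆ ∪ ⁅ y ⁆) ≡ false
      dep = trans (cong (indep M) (sym W+xy)) dep-xy
      dep′ : indep M (⁅ y ⁆ ∪ ⁅ x ⁆) ≡ false
      dep′ = trans (cong (indep M) (∪-comm ⁅ y ⁆ ⁅ x ⁆)) dep
      exchange : ∀ u v {A B} → A ≡ U ∪ ⁅ u ⁆ → B ≡ U ∪ ⁅ v ⁆ → indep M ⁅ v ⁆ ≡ true →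
                 indep M (⁅ u ⁆ ∪ ⁅ v ⁆) ≡ false → ∣ U ∪ ⁅ v ⁆ ∣ ≤ ∣ U ∪ ⁅ u ⁆ ∣ →
                 indep M A ≡ true → indep M B ≡ true
      exchange u v A≡U+u B≡U+v indv dep-uv size indA =
        trans (cong (indep M) B≡U+v) (parallel-exchange M (trans (cong (indep M) (sym A≡U+u)) indA) indv dep-uv size)

    -- Contracting x
    -- and then y uses the flags a = [x is not a loop of M] and b = [y is not a loop of M / x], and
    -- symmetrically in the other order; the flags can only differ when x and y are parallel.
    flags-agree : ∀ T → indW T (indW ⊥ true false) (indW ⊥ (indW ⊥ true false) true)
                      ≡ indW T (indW ⊥ true (indW ⊥ false true)) (indW ⊥ false true)
    flags-agree T with indW ⊥ true false in indx
    ... | false = cong (λ a → indW T a (indW ⊥ false true)) (sym (dependent-⊆ M (insertAt-⊆ y id λ ()) indx))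
    ... | true with indW ⊥ false true in indy
    ...   | false = cong₂ (indW T) (sym indx)
                          (dependent-⊆ M (insertAt-⊆ y (insertAt-⊆ i id λ ()) id) indy)
    ...   | true with indW ⊥ true true in indxy
    ...     | true  = refl
    ...     | false = parallel indx indy indxy T

  contract-comm : ∀ T → indep (contract (contract M (inject₁ i)) j) T ≡
                        indep (contract (contract M (suc j)) i) T
  contract-comm T = begin
    indep M (insertAt (insertAt T j b₁) x a₁)
      ≡⟨ cong (indep M) (insertAt-comm T i j a₁ b₁ i≤j) ⟩
    indW T a₁ b₁
      ≡⟨ cong₂ (indW T) a₁≡ b₁≡ ⟩
    indW T (indW ⊥ true false) (indW ⊥ (indW ⊥ true false) true)
      ≡⟨ flags-agree T ⟩
    indW T (indW ⊥ true (indW ⊥ false true)) (indW ⊥ false true)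
      ≡⟨ cong₂ (indW T) a₂≡ b₂≡ ⟨
    indep M (insertAt (insertAt T i a₂) y b₂)
      ∎
    where
    open ≡-Reasoning
    a₁ = indep M ⁅ x ⁆
    b₁ = indep M (insertAt ⁅ j ⁆ x a₁)
    b₂ = indep M ⁅ y ⁆
    a₂ = indep M (insertAt ⁅ i ⁆ y b₂)
    a₁≡ : a₁ ≡ indW ⊥ true false
    a₁≡ = cong (indep M) ⁅x⁆≡W
    b₁≡ : b₁ ≡ indW ⊥ (indW ⊥ true false) true
    b₁≡ = trans (cong (indep M) (⁅y⁆+x a₁)) (cong (λ a → indW ⊥ a true) a₁≡)
    b₂≡ : b₂ ≡ indW ⊥ false true
    b₂≡ = cong (indep M) ⁅y⁆≡W
    a₂≡ : a₂ ≡ indW ⊥ true (indW ⊥ false true)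
    a₂≡ = trans (cong (indep M) (⁅x⁆+y b₂)) (cong (indW ⊥ true) b₂≡)

-- The complexes of removals

-- ∂[ true ] sums over the removals that lower the rank, ∂[ false ] over those that lower the nullity.
module RemovalComplex
  (remove      : ∀ {n} → Matroid (suc n) → Fin (suc n) → Matroid n)
  (drops       : ∀ {n} → Matroid (suc n) → Fin (suc n) → Bool)
  (rk-remove   : ∀ {n} (M : Matroid (suc n)) x → rk M ≡ bit (drops M x) + rk (remove M x))
  (remove-comm : ∀ {n} (M : Matroid (suc (suc n))) {i j : Fin (suc n)} → toℕ i ≤ toℕ j →
                 ∀ T → indep (remove (remove M (inject₁ i)) j) T ≡ indep (remove (remove M (suc j)) i) T)
  where

  removal : ∀ {n} → Bool → Matroid (suc n) → Sign → Fin (suc n) → FSum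
  removal {n} c M η x = if c == drops M x then (1ℚ , (n , remove M x , ι x η)) ∷ [] else []

  ∂[_] : Bool → Gen → FSum
  ∂[ c ] (zero  , M , η) = []
  ∂[ c ] (suc n , M , η) = concatMap (removal c M η) (allFin (suc n))

  term : ∀ {n} → Matroid (suc (suc n)) → Sign → Fin (suc (suc n)) → Fin (suc n) → ℚ × Gen
  term {n} M η x y = (1ℚ *ℚ 1ℚ , (n , remove (remove M x) y , ι y (ι x η)))

  rank-lost : ∀ {n} → Matroid (suc (suc n)) → Fin (suc (suc n)) → Fin (suc n) → ℕ
  rank-lost M x y = bit (drops M x) + bit (drops (remove M x) y)

  rank-lost-sym : ∀ {n} (M : Matroid (suc (suc n))) {i j : Fin (suc n)} → toℕ i ≤ toℕ j →
                  rank-lost M (inject₁ i) j ≡ rank-lost M (suc j) i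
  rank-lost-sym M {i} {j} i≤j = ℕ.+-cancelʳ-≡ (rk M₁₂) _ _ (begin
    rank-lost M x j + rk M₁₂                          ≡⟨ ℕ.+-assoc (bit (drops M x)) _ _ ⟩
    bit (drops M x) + (bit (drops M₁ j) + rk M₁₂)     ≡⟨ cong (bit (drops M x) +_) (rk-remove M₁ j) ⟨
    bit (drops M x) + rk M₁                           ≡⟨ rk-remove M x ⟨
    rk M                                              ≡⟨ rk-remove M y ⟩
    bit (drops M y) + rk M₂                           ≡⟨ cong (bit (drops M y) +_) (rk-remove M₂ i) ⟩
    bit (drops M y) + (bit (drops M₂ i) + rk M₂₁)     ≡⟨ ℕ.+-assoc (bit (drops M y)) _ _ ⟨
    rank-lost M y i + rk M₂₁                          ≡⟨ cong (rank-lost M y i +_) M₁₂≡M₂₁ ⟨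
    rank-lost M y i + rk M₁₂                          ∎)
    where
    open ≡-Reasoning
    x = inject₁ i
    y = suc j
    M₁ = remove M x
    M₂ = remove M y
    M₁₂ = remove M₁ j
    M₂₁ = remove M₂ i
    M₁₂≡M₂₁ : rk M₁₂ ≡ rk M₂₁
    M₁₂≡M₂₁ = rk-cong {M = M₁₂} {M₂₁} (remove-comm M i≤j)

  routes-cancel : ∀ {n} (M : Matroid (suc (suc n))) η {i j : Fin (suc n)} → toℕ i ≤ toℕ j →
                  term M η (inject₁ i) j ∷ term M η (suc j) i ∷ [] ≈ []
  routes-cancel {n} M η {i} {j} i≤j = begin
    term M η (inject₁ i) j ∷ term M η (suc j) i ∷ []
      ≡⟨ cong (λ s → term M η (inject₁ i) j ∷ (_ , (n , _ , s)) ∷ []) signs ⟩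
    term M η (inject₁ i) j ∷ (1ℚ *ℚ 1ℚ , (n , remove (remove M (suc j)) i , opposite σ)) ∷ []
      ≈⟨ opposite-orientations-cancel _ n _ _ σ (remove-comm M i≤j) ⟩
    []
      ∎
    where
    open ≈-Reasoning
    σ = ι j (ι (inject₁ i) η)
    signs : ι i (ι (suc j) η) ≡ opposite σ
    signs rewrite toℕ-inject₁ i = swap-opposite (signPow (toℕ j)) (signPow (toℕ i)) η

  sum-of-routes-vanishes : ∀ {n} (M : Matroid (suc (suc n))) η (P : ℕ → Bool) →
                           sumPairs (suc n) (λ x y → if P (rank-lost M x y) then term M η x y ∷ [] else []) ≈ []
  sum-of-routes-vanishes {n} M η P = sumPairs-vanishes (suc n) route λ i j i≤j →
    subst (λ k → route (inject₁ i) j ++ (if P k then term M η (suc j) i ∷ [] else []) ≈ [])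
          (rank-lost-sym M i≤j)
          (if-pair-cancel (P (rank-lost M (inject₁ i) j)) (routes-cancel M η i≤j))
    where
    route : Fin (suc (suc n)) → Fin (suc n) → FSum
    route x y = if P (rank-lost M x y) then term M η x y ∷ [] else []

  ∂∂-expand : ∀ c₂ c₁ {n} (M : Matroid (suc (suc n))) η →
              linExt ∂[ c₂ ] (∂[ c₁ ] (suc (suc n) , M , η)) ≡
              sumPairs (suc n) (λ x y → if (c₁ == drops M x) ∧ (c₂ == drops (remove M x) y)
                                        then term M η x y ∷ [] else [])
  ∂∂-expand c₂ c₁ {n} M η =
    trans (linExt-concatMap ∂[ c₂ ] (removal c₁ M η) (allFin (suc (suc n))))
          (concatMap-cong expand-at (allFin (suc (suc n))))
    where
    expand-at : ∀ x → linExt ∂[ c₂ ] (removal c₁ M η x) ≡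
                      concatMap (λ y → if (c₁ == drops M x) ∧ (c₂ == drops (remove M x) y)
                                       then term M η x y ∷ [] else [])
                                (allFin (suc n))
    expand-at x with c₁ == drops M x
    ... | false = sym (concatMap-[] (allFin (suc n)))
    ... | true  = trans (++-identityʳ _) (trans (map-concatMap _ _ (allFin (suc n)))
                        (concatMap-cong (λ y → map-if _ (c₂ == drops (remove M x) y) _) (allFin (suc n))))

  ∂∂-singleton : ∀ c₂ c₁ (M : Matroid 1) η → linExt ∂[ c₂ ] (∂[ c₁ ] (1 , M , η)) ≡ []
  ∂∂-singleton c₂ c₁ M η with c₁ == drops M zero
  ... | true  = refl
  ... | false = refl

  ∂²-vanishes-at : ∀ c g → linExt ∂[ c ] (∂[ c ] g) ≈ []
  ∂²-vanishes-at c (zero , M , η)        = ≈-refl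
  ∂²-vanishes-at c (suc zero , M , η)    = ≡⇒≈ (∂∂-singleton c c M η)
  ∂²-vanishes-at c (suc (suc n) , M , η) = begin
    linExt ∂[ c ] (∂[ c ] (suc (suc n) , M , η))
      ≡⟨ ∂∂-expand c c M η ⟩
    sumPairs (suc n) (λ x y → if (c == drops M x) ∧ (c == drops (remove M x) y) then term M η x y ∷ [] else [])
      ≡⟨ sumPairs-cong (suc n) (λ x y → cong (λ b → if b then term M η x y ∷ [] else []) (both-equal c _ _)) ⟩
    sumPairs (suc n) (λ x y → if rank-lost M x y ≡ᵇ bit c + bit c then term M η x y ∷ [] else [])
      ≈⟨ sum-of-routes-vanishes M η (_≡ᵇ bit c + bit c) ⟩
    []
      ∎
    where open ≈-Reasoning

  anticommutator-at : ∀ g → linExt ∂[ false ] (∂[ true ] g) ++ linExt ∂[ true ] (∂[ false ] g) ≈ []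
  anticommutator-at (zero , M , η)        = ≈-refl
  anticommutator-at (suc zero , M , η)    =
    ≡⇒≈ (cong₂ _++_ (∂∂-singleton false true M η) (∂∂-singleton true false M η))
  anticommutator-at (suc (suc n) , M , η) = begin
    linExt ∂[ false ] (∂[ true ] g) ++ linExt ∂[ true ] (∂[ false ] g)
      ≡⟨ cong₂ _++_ (∂∂-expand false true M η) (∂∂-expand true false M η) ⟩
    sumPairs (suc n) F ++ sumPairs (suc n) G
      ≈⟨ ≈-perm (↭-sym (sumPairs-+ (suc n) F G)) ⟩
    sumPairs (suc n) (λ x y → F x y ++ G x y)
      ≡⟨ sumPairs-cong (suc n) (λ x y → exactly-one (drops M x) (drops (remove M x) y) (term M η x y)) ⟩
    sumPairs (suc n) (λ x y → if rank-lost M x y ≡ᵇ 1 then term M η x y ∷ [] else [])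
      ≈⟨ sum-of-routes-vanishes M η (_≡ᵇ 1) ⟩
    []
      ∎
    where
    open ≈-Reasoning
    g = (suc (suc n) , M , η)
    F G : Fin (suc (suc n)) → Fin (suc n) → FSum
    F x y = if drops M x ∧ not (drops (remove M x) y) then term M η x y ∷ [] else []
    G x y = if not (drops M x) ∧ drops (remove M x) y then term M η x y ∷ [] else []

  bicomplex : IsBicomplex (linExt ∂[ false ]) (linExt ∂[ true ])
  bicomplex = square-vanishes ∂[ false ] (∂²-vanishes-at false)
            , square-vanishes ∂[ true ] (∂²-vanishes-at true)
            , anticommutator-vanishes ∂[ false ] ∂[ true ] anticommutator-at

  rk-remove-by : ∀ {n} (M : Matroid (suc n)) x {d} → drops M x ≡ d → rk M ≡ bit d + rk (remove M x)
  rk-remove-by M x refl = rk-remove M x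

  lowers-nullity : Bidegree-10 ∂[ false ]
  lowers-nullity (zero  , M , η) = []
  lowers-nullity (suc n , M , η) =
    All-concatMap (removal false M η)
      (λ x → All-if (not (drops M x)) λ kept →
         rank-kept⇒nullity-drop {M = M} {remove M x}
           (rk-remove-by M x (trans (sym (not-involutive _)) (cong not kept))))
      (allFin (suc n))

  lowers-rank : Bidegree-01 ∂[ true ]
  lowers-rank (zero  , M , η) = []
  lowers-rank (suc n , M , η) =
    All-concatMap (removal true M η)
      (λ x → All-if (drops M x) λ dropped →
         rank-drop⇒nullity-kept {M = M} {remove M x} (rk-remove-by M x dropped))
      (allFin (suc n))

module Deletion    = RemovalComplex delete isColoop rk-delete delete-comm
module Contraction = RemovalComplex contract (λ M x → not (isLoop M x)) rk-contract contract-comm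

∂del-via-removal : ∀ g → Deletion.∂[ false ] g ≡ ∂delGen g
∂del-via-removal (zero  , M , η) = refl
∂del-via-removal (suc n , M , η) = refl

∂clp-via-removal : ∀ g → Deletion.∂[ true ] g ≡ ∂clpGen g
∂clp-via-removal (zero  , M , η) = refl
∂clp-via-removal (suc n , M , η) = refl

∂lp-via-removal : ∀ g → Contraction.∂[ false ] g ≡ ∂lpGen g
∂lp-via-removal (zero  , M , η) = refl
∂lp-via-removal (suc n , M , η) =
  concatMap-cong (λ x → cong (λ b → if b then (1ℚ , (n , contract M x , ι x η)) ∷ [] else [])
                             (not-involutive (isLoop M x)))
                 (allFin (suc n))

∂con-via-removal : ∀ g → Contraction.∂[ true ] g ≡ ∂conGen g
∂con-via-removal (zero  , M , η) = refl
∂con-via-removal (suc n , M , η) = refl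

proposition3p11 : (IsBicomplex ∂del ∂clp × Bidegree-10 ∂delGen × Bidegree-01 ∂clpGen)
                  × (IsBicomplex ∂lp ∂con × Bidegree-10 ∂lpGen × Bidegree-01 ∂conGen)
proposition3p11 =
  ( ( IsBicomplex-cong ∂del-via-removal ∂clp-via-removal Deletion.bicomplex
    , (λ g → subst (All _) (∂del-via-removal g) (Deletion.lowers-nullity g))
    , (λ g → subst (All _) (∂clp-via-removal g) (Deletion.lowers-rank g)) )
  , ( IsBicomplex-cong ∂lp-via-removal ∂con-via-removal Contraction.bicomplex
    , (λ g → subst (All _) (∂lp-via-removal g) (Contraction.lowers-nullity g))
    , (λ g → subst (All _) (∂con-via-removal g) (Contraction.lowers-rank g)) ) )
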